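{- Fix a mode theory $\mathcal{M}$ (a strict 2-category) and consider the multimodal $\lambda$-calculus and the partial operation $M\{\Gamma,\alpha,\Delta\}$ described in the context. For all pre-contexts $\Gamma,\Delta$, parallel modalities $\mu,\nu:n\to m$, transformation $\alpha:\mu\Rightarrow\nu$, mode $p$, term $M$ and type $A$: if $\Gamma.\mathsf{lock}_\mu,\Delta\vdash M : A\ @\,p$ is derivable, then $M\{\Gamma,\alpha,\Delta\}$ is defined and $\Gamma.\mathsf{lock}_\nu,\Delta\vdash M\{\Gamma,\alpha,\Delta\} : A\ @\,p$ is derivable.
   Context: A mode theory is a strict 2-category $\mathcal{M}$: objects are modes; 1-cells $\mu:n\to m$ are modalities, with composition $\mu\circ\nu$ and identities $1_m$; 2-cells $\alpha:\mu\Rightarrow\nu$ between parallel modalities are transformations, with vertical composition $\beta\circ\alpha$, identities $1_\mu$ and horizontal composition $\alpha*\beta:\mu\circ\theta\Rightarrow\nu\circ\xi$ for $\alpha:\mu\Rightarrow\nu$, $\beta:\theta\Rightarrow\xi$, obeying the strict 2-category laws. Types: pre-types $A,B ::= p_i \mid \bot \mid \top \mid A+B \mid A\times B \mid (\mu\mid A)\to B \mid \langle\mu\mid A\rangle$; "$A$ type $@\,m$" is generated by: $p_i,\top,\bot$ are types at every mode; $A\times B$, $A+B$ type $@\,m$ if $A,B$ type $@\,m$; $(\mu\mid A)\to B$ type $@\,m$ if $\mu:n\to m$, $A$ type $@\,n$, $B$ type $@\,m$; $\langle\mu\mid A\rangle$ type $@\,m$ if $A$ type $@\,n$ and $\mu:n\to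 m$. Contexts: pre-contexts $\Gamma ::= \cdot \mid \Gamma, x:(\mu\mid A)\mid \Gamma.\mathsf{lock}_\mu$; "$\Gamma$ ctx $@\,m$" is generated by: $\cdot$ ctx $@\,m$; $\Gamma, x:(\mu\mid A)$ ctx $@\,m$ if $\Gamma$ ctx $@\,m$, $A$ type $@\,n$, $\mu:n\to m$, $x$ fresh; $\Gamma.\mathsf{lock}_\mu$ ctx $@\,n$ if $\Gamma$ ctx $@\,m$ and $\mu:n\to m$. Contexts are identified modulo $\Gamma.\mathsf{lock}_{1_m}=\Gamma$ and $\Gamma.\mathsf{lock}_\mu.\mathsf{lock}_\nu=\Gamma.\mathsf{lock}_{\mu\circ\nu}$. $\Gamma,\Delta$ is concatenation. Define $|\cdot|=1$, $|\Gamma,x:(\mu\mid A)|=|\Gamma|$, $|\Gamma.\mathsf{lock}_\mu|=|\Gamma|\circ\mu$. Typing judgement $\Gamma\vdash M:A\ @\,m$ generated by (premises at mode $m$ unless indicated; bound variables up to capture-avoiding renaming): (var) if $\mu:n\to m$ and $\alpha:\mu\Rightarrow|\Delta|$ then $\Gamma, x:(\mu\mid A),\Delta\vdash x_\alpha : A\ @\,n$; (pair) from $M:A$, $N:B$ infer $\langle M,N\rangle : A\times B$; (proj) from $P:A_1\times A_2$ infer $\pi_i(P):A_i$; (lam) from $\Gamma,x:(\mu\mid A)\vdash M:B$ infer $\Gamma\vdash\lambda x.M : (\mu\mid A)\to B$; (app) if $\mu:n\to m$, from $\Gamma\vdash M:(\mu\mid A)\to B\ @\,m$ and $\Gamma.\mathsf{lock}_\mu\vdash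 N:A\ @\,n$ infer $\Gamma\vdash M\,@_\mu N : B\ @\,m$; (inj) from $M:A_i$ infer $\mathsf{in}_i(M):A_1+A_2$; (case) from $\Gamma\vdash M:A+B$, $\Gamma,x:(1\mid A)\vdash P:C$, $\Gamma,y:(1\mid B)\vdash Q:C$ infer $\Gamma\vdash\mathsf{case}\ M\ \mathsf{of}\ (x.P;\ y.Q):C$; (mod) if $\mu:n\to m$, from $\Gamma.\mathsf{lock}_\mu\vdash M:A\ @\,n$ infer $\Gamma\vdash\mathsf{mod}_\mu(M):\langle\mu\mid A\rangle\ @\,m$; (let) if $\nu:o\to n$, $\mu:n\to m$, from $\Gamma.\mathsf{lock}_\mu\vdash M:\langle\nu\mid A\rangle\ @\,n$ and $\Gamma,x:(\mu\circ\nu\mid A)\vdash N:B\ @\,m$ infer $\Gamma\vdash\mathsf{let}_\mu\ \mathsf{mod}_\nu(x)=M\ \mathsf{in}\ N : B\ @\,m$. Lock-weakening operation. For a 2-cell $\alpha$ and disjoint pre-contexts $\Gamma,\Delta$, the partial operation $M\{\Gamma,\alpha,\Delta\}$ is defined by recursion on $M$: - if $\Gamma = \Gamma_0, x:(\rho\mid A), \Gamma'$, then $x_{\alpha'}\{\Gamma,\alpha,\Delta\} = x_{(1_{|\Gamma'|} * \alpha * 1_{|\Delta|})\circ\alpha'}$; - if $\Delta = \Delta_0, x:(\rho\mid A),\Delta'$, then $x_{\alpha'}\{\Gamma,\alpha,\Delta\} = x_{\alpha'}$; - $(\lambda x.M)\{\Gamma,\alpha,\Delta\} = \lambda x.\,M\{\Gamma,\alpha,(\Delta,x:(\xi\mid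 A))\}$ where $x$ is bound with tag $\xi$ and type $A$; - $(M\,@_\xi N)\{\Gamma,\alpha,\Delta\} = M\{\Gamma,\alpha,\Delta\}\,@_\xi\,N\{\Gamma,\alpha,\Delta.\mathsf{lock}_\xi\}$; - $\mathsf{mod}_\xi(M)\{\Gamma,\alpha,\Delta\} = \mathsf{mod}_\xi(M\{\Gamma,\alpha,\Delta.\mathsf{lock}_\xi\})$; - $\langle M,N\rangle$, $\pi_i(M)$, $\mathsf{in}_i(M)$: apply the operation with the same parameters to the immediate subterms; - $(\mathsf{let}_\rho\ \mathsf{mod}_\xi(x)=M\ \mathsf{in}\ N)\{\Gamma,\alpha,\Delta\} = \mathsf{let}_\rho\ \mathsf{mod}_\xi(x)=M\{\Gamma,\alpha,\Delta.\mathsf{lock}_\rho\}\ \mathsf{in}\ N\{\Gamma,\alpha,(\Delta,x:(\rho\circ\xi\mid A))\}$; - $(\mathsf{case}\ M\ \mathsf{of}\ (x.P;y.Q))\{\Gamma,\alpha,\Delta\} = \mathsf{case}\ M\{\Gamma,\alpha,\Delta\}\ \mathsf{of}\ (x.P\{\Gamma,\alpha,(\Delta,x:(1\mid A))\};\ y.Q\{\Gamma,\alpha,(\Delta,y:(1\mid B))\})$. It is undefined when no clause applies (e.g. a variable declared in neither $\Gamma$ nor $\Delta$, or an ill-typed composite 2-cell). -}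

module Defs where

open import Level using (Level; _⊔_) renaming (suc to lsuc)
open import Data.Nat using (ℕ; zero; suc; _+_; _<_)
open import Data.Product using (Σ; _,_; _×_)
open import Relation.Binary.PropositionalEquality using (_≡_; subst₂)

-- Mode       : objects (modes)
--   Hom n m    : 1-cells μ : n → m (modalities)
--   μ ⊚ ν      : composition μ ∘ ν   (ν : o → n, μ : n → m)
--   id₁ m      : identity 1_m
--   Cell μ ν   : 2-cells α : μ ⇒ ν
--   β · α      : vertical composition β ∘ α
--   id₂ μ      : identity 2-cell 1_μ
--   α * β      : horizontal composition  α * β : μ ∘ θ ⇒ ν ∘ ξ
-- with all strict 2-category laws (equalities of 2-cells whose types only
-- agree up to the 1-cell laws are stated after transport along them).

record ModeTheory (o ℓ₁ ℓ₂ : Level) : Set (lsuc (o ⊔ ℓ₁ ⊔ ℓ₂)) where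
  infixr 9 _⊚_
  infixl 8 _*_
  infixr 7 _·_
  field
    Mode : Set o
    Hom  : Mode → Mode → Set ℓ₁
    _⊚_  : ∀ {o n m} → Hom n m → Hom o n → Hom o m
    id₁  : ∀ m → Hom m m
    ⊚-assoc     : ∀ {a b c d} (μ : Hom c d) (ν : Hom b c) (ρ : Hom a b) →
                  (μ ⊚ ν) ⊚ ρ ≡ μ ⊚ (ν ⊚ ρ)
    ⊚-identityˡ : ∀ {n m} (μ : Hom n m) → id₁ m ⊚ μ ≡ μ
    ⊚-identityʳ : ∀ {n m} (μ : Hom n m) → μ ⊚ id₁ n ≡ μ

    Cell : ∀ {n m} → Hom n m → Hom n m → Set ℓ₂
    _·_  : ∀ {n m} {μ ν ρ : Hom n m} → Cell ν ρ → Cell μ ν → Cell μ ρ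
    id₂  : ∀ {n m} (μ : Hom n m) → Cell μ μ
    _*_  : ∀ {o n m} {μ ν : Hom n m} {θ ξ : Hom o n} →
           Cell μ ν → Cell θ ξ → Cell (μ ⊚ θ) (ν ⊚ ξ)

    ·-assoc     : ∀ {n m} {μ ν ρ σ : Hom n m}
                  (γ : Cell ρ σ) (β : Cell ν ρ) (α : Cell μ ν) →
                  (γ · β) · α ≡ γ · (β · α)
    ·-identityˡ : ∀ {n m} {μ ν : Hom n m} (α : Cell μ ν) → id₂ ν · α ≡ α
    ·-identityʳ : ∀ {n m} {μ ν : Hom n m} (α : Cell μ ν) → α · id₂ μ ≡ α

    *-assoc     : ∀ {a b c d} {μ ν : Hom c d} {θ ξ : Hom b c} {ψ χ : Hom a b}
                  (α : Cell μ ν) (β : Cell θ ξ) (γ : Cell ψ χ) →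
                  subst₂ Cell (⊚-assoc μ θ ψ) (⊚-assoc ν ξ χ) ((α * β) * γ)
                    ≡ α * (β * γ)
    *-identityˡ : ∀ {n m} {μ ν : Hom n m} (α : Cell μ ν) →
                  subst₂ Cell (⊚-identityˡ μ) (⊚-identityˡ ν) (id₂ (id₁ m) * α) ≡ α
    *-identityʳ : ∀ {n m} {μ ν : Hom n m} (α : Cell μ ν) →
                  subst₂ Cell (⊚-identityʳ μ) (⊚-identityʳ ν) (α * id₂ (id₁ n)) ≡ α
    id₂-*       : ∀ {o n m} (μ : Hom n m) (θ : Hom o n) →
                  id₂ μ * id₂ θ ≡ id₂ (μ ⊚ θ)
    interchange : ∀ {o n m} {μ ν ρ : Hom n m} {θ ξ ζ : Hom o n}
                  (β : Cell ν ρ) (α : Cell μ ν) (δ : Cell ξ ζ) (γ : Cell θ ξ) →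
                  (β · α) * (δ · γ) ≡ (β * δ) · (α * γ)

module Syntax {o ℓ₁ ℓ₂ : Level} (𝓜 : ModeTheory o ℓ₁ ℓ₂) where

  open ModeTheory 𝓜 public

  L : Level
  L = o ⊔ ℓ₁ ⊔ ℓ₂

  -- Types:  Ty m  is the set of pre-types A with "A type @ m".
  infixr 6 [_∣_]⇒_
  data Ty : Mode → Set L where
    atom     : ∀ {m} → ℕ → Ty m
    ⊥ty ⊤ty  : ∀ {m} → Ty m
    _+ty_    : ∀ {m} → Ty m → Ty m → Ty m
    _×ty_    : ∀ {m} → Ty m → Ty m → Ty m
    [_∣_]⇒_  : ∀ {n m} → Hom n m → Ty n → Ty m → Ty m
    ⟨_∣_⟩    : ∀ {n m} → Hom n m → Ty n → Ty m

  -- Tel k m : pre-contexts Γ with "Γ ctx @ m", built up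
  -- from the empty context · at mode k (k is the mode of the leading ·).
  -- Variables are anonymous (de Bruijn): x : (μ ∣ A) is written ▸[ μ ∣ A ].
  infixl 6 _▸[_∣_] _🔒_
  data Tel : Mode → Mode → Set L where
    ◇        : ∀ {m} → Tel m m
    _▸[_∣_]  : ∀ {k n m} → Tel k m → Hom n m → Ty n → Tel k m
    _🔒_     : ∀ {k n m} → Tel k m → Hom n m → Tel k n

  ∣_∣ : ∀ {k m} → Tel k m → Hom m k
  ∣ ◇ ∣            = id₁ _
  ∣ Γ ▸[ μ ∣ A ] ∣ = ∣ Γ ∣
  ∣ Γ 🔒 μ ∣       = ∣ Γ ∣ ⊚ μ

  infixl 5 _++_
  _++_ : ∀ {k m n} → Tel k m → Tel m n → Tel k n
  Γ ++ ◇            = Γ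
  Γ ++ (Δ ▸[ μ ∣ A ]) = (Γ ++ Δ) ▸[ μ ∣ A ]
  Γ ++ (Δ 🔒 μ)     = (Γ ++ Δ) 🔒 μ

  nvars : ∀ {k m} → Tel k m → ℕ
  nvars ◇              = zero
  nvars (Γ ▸[ μ ∣ A ]) = suc (nvars Γ)
  nvars (Γ 🔒 μ)       = nvars Γ

  -- Packed modalities / 2-cells, as annotations stored in raw terms.
  Hom⁺ : Set (o ⊔ ℓ₁)
  Hom⁺ = Σ Mode λ n → Σ Mode λ m → Hom n m

  ⌜_⌝ : ∀ {n m} → Hom n m → Hom⁺
  ⌜ μ ⌝ = _ , _ , μ

  Cell⁺ : Set L
  Cell⁺ = Σ Mode λ n → Σ Mode λ m → Σ (Hom n m) λ μ → Σ (Hom n m) λ ν → Cell μ ν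

  ⌜_⌝₂ : ∀ {n m} {μ ν : Hom n m} → Cell μ ν → Cell⁺
  ⌜ α ⌝₂ = _ , _ , _ , _ , α

  -- Raw (pre-)terms.  A variable occurrence x_α is  var i ⌜α⌝₂  where i is
  -- the de Bruijn index of x (number of variables declared after x).
  data Tm : Set L where
    var  : ℕ → Cell⁺ → Tm
    pair : Tm → Tm → Tm
    π₁ π₂ : Tm → Tm
    lam  : Tm → Tm
    app  : Tm → Hom⁺ → Tm → Tm
    in₁ in₂ : Tm → Tm
    case : Tm → Tm → Tm → Tm
    mod  : Hom⁺ → Tm → Tm
    letmod : Hom⁺ → Hom⁺ → Tm → Tm → Tm

  infix 3 _⊢_∶_
  data _⊢_∶_ : ∀ {k m} → Tel k m → Tm → Ty m → Set L where
    var  : ∀ {k m n} {Ψ : Tel k n} {i : ℕ} {c : Cell⁺} {A : Ty n}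
           (Γ : Tel k m) (μ : Hom n m) (Δ : Tel m n) (α : Cell μ ∣ Δ ∣) →
           Ψ ≡ (Γ ▸[ μ ∣ A ]) ++ Δ → i ≡ nvars Δ → c ≡ ⌜ α ⌝₂ →
           Ψ ⊢ var i c ∶ A
    pair : ∀ {k m} {Γ : Tel k m} {M N A B} →
           Γ ⊢ M ∶ A → Γ ⊢ N ∶ B → Γ ⊢ pair M N ∶ A ×ty B
    π₁   : ∀ {k m} {Γ : Tel k m} {P A B} → Γ ⊢ P ∶ A ×ty B → Γ ⊢ π₁ P ∶ A
    π₂   : ∀ {k m} {Γ : Tel k m} {P A B} → Γ ⊢ P ∶ A ×ty B → Γ ⊢ π₂ P ∶ B
    lam  : ∀ {k m n} {Γ : Tel k m} {μ : Hom n m} {A : Ty n} {B M} →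
           Γ ▸[ μ ∣ A ] ⊢ M ∶ B → Γ ⊢ lam M ∶ [ μ ∣ A ]⇒ B
    app  : ∀ {k m n} {Γ : Tel k m} {μ : Hom n m} {A : Ty n} {B M N} →
           Γ ⊢ M ∶ [ μ ∣ A ]⇒ B → Γ 🔒 μ ⊢ N ∶ A → Γ ⊢ app M ⌜ μ ⌝ N ∶ B
    in₁  : ∀ {k m} {Γ : Tel k m} {M A B} → Γ ⊢ M ∶ A → Γ ⊢ in₁ M ∶ A +ty B
    in₂  : ∀ {k m} {Γ : Tel k m} {M A B} → Γ ⊢ M ∶ B → Γ ⊢ in₂ M ∶ A +ty B
    case : ∀ {k m} {Γ : Tel k m} {M P Q A B C} →
           Γ ⊢ M ∶ A +ty B → Γ ▸[ id₁ m ∣ A ] ⊢ P ∶ C → Γ ▸[ id₁ m ∣ B ] ⊢ Q ∶ C →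
           Γ ⊢ case M P Q ∶ C
    mod  : ∀ {k m n} {Γ : Tel k m} {μ : Hom n m} {A : Ty n} {M} →
           Γ 🔒 μ ⊢ M ∶ A → Γ ⊢ mod ⌜ μ ⌝ M ∶ ⟨ μ ∣ A ⟩
    letmod : ∀ {k m n o'} {Γ : Tel k m} {ν : Hom o' n} {μ : Hom n m} {A : Ty o'} {B M N} →
           Γ 🔒 μ ⊢ M ∶ ⟨ ν ∣ A ⟩ → Γ ▸[ μ ⊚ ν ∣ A ] ⊢ N ∶ B →
           Γ ⊢ letmod ⌜ μ ⌝ ⌜ ν ⌝ M N ∶ B

  -- Lock weakening, as the graph of the partial operation:
  --   Wk Γ α Δ M M'   means   M{Γ,α,Δ} is defined and equals M'.
  -- The variable/binder information (ξ, A) pushed onto Δ by binders does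
  -- not influence the result (only the number of variables and the locks
  -- of Δ matter), so the binder clauses accept any such annotation.
  data Wk {k m n : Mode} {μ ν : Hom n m} (Γ : Tel k m) (α : Cell μ ν) :
          ∀ {p} → Tel n p → Tm → Tm → Set L where
    varΔ : ∀ {p} {Δ : Tel n p} {i c} → i < nvars Δ → Wk Γ α Δ (var i c) (var i c)
    varΓ : ∀ {p m'} {Δ : Tel n p} {i c}
           (Γ₀ : Tel k m') (ρ : Hom p m') (A : Ty p) (Γ' : Tel m' m)
           (α' : Cell ρ ((∣ Γ' ∣ ⊚ μ) ⊚ ∣ Δ ∣)) →
           Γ ≡ (Γ₀ ▸[ ρ ∣ A ]) ++ Γ' → i ≡ nvars Δ + nvars Γ' → c ≡ ⌜ α' ⌝₂ →
           Wk Γ α Δ (var i c) (var i ⌜ ((id₂ ∣ Γ' ∣ * α) * id₂ ∣ Δ ∣) · α' ⌝₂)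
    lam  : ∀ {p q} {Δ : Tel n p} {M M'} (ξ : Hom q p) (A : Ty q) →
           Wk Γ α (Δ ▸[ ξ ∣ A ]) M M' → Wk Γ α Δ (lam M) (lam M')
    app  : ∀ {p q} {Δ : Tel n p} {M M' N N'} (ξ : Hom q p) →
           Wk Γ α Δ M M' → Wk Γ α (Δ 🔒 ξ) N N' →
           Wk Γ α Δ (app M ⌜ ξ ⌝ N) (app M' ⌜ ξ ⌝ N')
    mod  : ∀ {p q} {Δ : Tel n p} {M M'} (ξ : Hom q p) →
           Wk Γ α (Δ 🔒 ξ) M M' → Wk Γ α Δ (mod ⌜ ξ ⌝ M) (mod ⌜ ξ ⌝ M')
    pair : ∀ {p} {Δ : Tel n p} {M M' N N'} →
           Wk Γ α Δ M M' → Wk Γ α Δ N N' → Wk Γ α Δ (pair M N) (pair M' N')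
    π₁   : ∀ {p} {Δ : Tel n p} {M M'} → Wk Γ α Δ M M' → Wk Γ α Δ (π₁ M) (π₁ M')
    π₂   : ∀ {p} {Δ : Tel n p} {M M'} → Wk Γ α Δ M M' → Wk Γ α Δ (π₂ M) (π₂ M')
    in₁  : ∀ {p} {Δ : Tel n p} {M M'} → Wk Γ α Δ M M' → Wk Γ α Δ (in₁ M) (in₁ M')
    in₂  : ∀ {p} {Δ : Tel n p} {M M'} → Wk Γ α Δ M M' → Wk Γ α Δ (in₂ M) (in₂ M')
    letmod : ∀ {p q r} {Δ : Tel n p} {M M' N N'} (ρ : Hom q p) (ξ : Hom r q) (A : Ty r) →
           Wk Γ α (Δ 🔒 ρ) M M' → Wk Γ α (Δ ▸[ ρ ⊚ ξ ∣ A ]) N N' →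
           Wk Γ α Δ (letmod ⌜ ρ ⌝ ⌜ ξ ⌝ M N) (letmod ⌜ ρ ⌝ ⌜ ξ ⌝ M' N')
    case : ∀ {p} {Δ : Tel n p} {M M' P P' Q Q'} (A B : Ty p) →
           Wk Γ α Δ M M' → Wk Γ α (Δ ▸[ id₁ p ∣ A ]) P P' →
           Wk Γ α (Δ ▸[ id₁ p ∣ B ]) Q Q' →
           Wk Γ α Δ (case M P Q) (case M' P' Q')

-- Only the variable rule is affected: a variable declared in Δ
-- keeps its annotation, while for x : (ρ ∣ A) declared in Γ = Γ₀, x, Γ' the annotation
-- α' : ρ ⇒ ∣ Γ' ∣ ∘ μ ∘ ∣ Δ ∣ is postcomposed with the whiskered cell 1 * α * 1, giving a
-- 2-cell into ∣ Γ' ∣ ∘ ν ∘ ∣ Δ ∣, which is exactly what the variable rule needs under lock ν.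
module Submission where

open import Defs
open import Level using (Level)
open import Data.Product using (Σ; _×_; _,_)
open import Data.Nat using (suc; _+_; _<_; s≤s)
open import Data.Nat.Properties using (m≤m+n; +-suc)
open import Relation.Binary.PropositionalEquality
open import Relation.Binary.HeterogeneousEquality using (_≅_; refl; ≅-to-≡)

module LockWeakening {o ℓ₁ ℓ₂ : Level} (𝓜 : ModeTheory o ℓ₁ ℓ₂) where
  open Syntax 𝓜

  ⌜⌝₂-subst : ∀ {n m} {ρ μ μ' : Hom n m} (e : μ ≡ μ') (β : Cell ρ μ) →
              ⌜ subst (Cell ρ) e β ⌝₂ ≡ ⌜ β ⌝₂
  ⌜⌝₂-subst refl β = refl

  ∣∣-++ : ∀ {k m n} (X : Tel k m) (Y : Tel m n) → ∣ X ++ Y ∣ ≡ ∣ X ∣ ⊚ ∣ Y ∣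
  ∣∣-++ X ◇              = sym (⊚-identityʳ ∣ X ∣)
  ∣∣-++ X (Y ▸[ ξ ∣ B ]) = ∣∣-++ X Y
  ∣∣-++ X (Y 🔒 ξ)       = trans (cong (_⊚ ξ) (∣∣-++ X Y)) (⊚-assoc _ _ _)

  nvars-++ : ∀ {k m n} (X : Tel k m) (Y : Tel m n) → nvars (X ++ Y) ≡ nvars Y + nvars X
  nvars-++ X ◇              = refl
  nvars-++ X (Y ▸[ ξ ∣ B ]) = cong suc (nvars-++ X Y)
  nvars-++ X (Y 🔒 ξ)       = nvars-++ X Y

  ++-assoc : ∀ {a b c d} (X : Tel a b) (Y : Tel b c) (Z : Tel c d) →
             (X ++ Y) ++ Z ≡ X ++ (Y ++ Z)
  ++-assoc X Y ◇              = refl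
  ++-assoc X Y (Z ▸[ ξ ∣ B ]) = cong (_▸[ ξ ∣ B ]) (++-assoc X Y Z)
  ++-assoc X Y (Z 🔒 ξ)       = cong (_🔒 ξ) (++-assoc X Y Z)

  nvars-<-▸-++ : ∀ {a b c q} (D : Tel a b) (ρ : Hom q b) (A : Ty q) (Y : Tel b c) →
                 nvars Y < nvars ((D ▸[ ρ ∣ A ]) ++ Y)
  nvars-<-▸-++ D ρ A Y rewrite nvars-++ (D ▸[ ρ ∣ A ]) Y | +-suc (nvars Y) (nvars D) =
    s≤s (m≤m+n (nvars Y) (nvars D))

  ▸-injective : ∀ {k p a b} {X Y : Tel k p} {ξ : Hom a p} {ξ' : Hom b p} {B : Ty a} {B' : Ty b} →
                X ▸[ ξ ∣ B ] ≡ Y ▸[ ξ' ∣ B' ] → X ≡ Y × a ≡ b × ξ ≅ ξ' × B ≅ B'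
  ▸-injective refl = refl , refl , refl , refl

  🔒-injective : ∀ {k p a b} {X : Tel k a} {Y : Tel k b} {ξ : Hom p a} {ξ' : Hom p b} →
                 X 🔒 ξ ≡ Y 🔒 ξ' → a ≡ b × X ≅ Y × ξ ≅ ξ'
  🔒-injective refl = refl , refl , refl

  data Split {k m p m' q} (X : Tel k m) (Δ : Tel m p)
             (Γ : Tel k m') (ρ : Hom q m') (A : Ty q) (Δ' : Tel m' p) : Set L where
    inʳ : (D : Tel m m') → Δ ≡ (D ▸[ ρ ∣ A ]) ++ Δ' → Split X Δ Γ ρ A Δ'
    inˡ : (G : Tel m' m) → X ≡ (Γ ▸[ ρ ∣ A ]) ++ G → Δ' ≡ G ++ Δ → Split X Δ Γ ρ A Δ'

  split-++ : ∀ {k m p m' q} (X : Tel k m) (Δ : Tel m p)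
             (Γ : Tel k m') (ρ : Hom q m') (A : Ty q) (Δ' : Tel m' p) →
             X ++ Δ ≡ (Γ ▸[ ρ ∣ A ]) ++ Δ' → Split X Δ Γ ρ A Δ'
  split-++ X ◇ Γ ρ A Δ' e = inˡ Δ' e refl
  split-++ X (Δ ▸[ ξ ∣ B ]) Γ ρ A ◇ refl = inʳ Δ refl
  split-++ X (Δ ▸[ ξ ∣ B ]) Γ ρ A (Δ' ▸[ ξ' ∣ B' ]) e
    with ▸-injective e
  ... | e' , refl , refl , refl with split-++ X Δ Γ ρ A Δ' e'
  ...   | inʳ D eD    = inʳ D (cong (_▸[ ξ ∣ B ]) eD)
  ...   | inˡ G eX eΔ = inˡ G eX (cong (_▸[ ξ ∣ B ]) eΔ)
  split-++ X (Δ 🔒 ξ) Γ ρ A (Δ' 🔒 ξ') e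
    with 🔒-injective e
  ... | refl , e' , refl with split-++ X Δ Γ ρ A Δ' (≅-to-≡ e')
  ...   | inʳ D eD    = inʳ D (cong (_🔒 ξ) eD)
  ...   | inˡ G eX eΔ = inˡ G eX (cong (_🔒 ξ) eΔ)

  🔒-▸-++ : ∀ {k m n m' q} {Γ : Tel k m} {μ : Hom n m} {Γ' : Tel k m'} {ρ : Hom q m'}
            {A : Ty q} (G : Tel m' n) → Γ 🔒 μ ≡ (Γ' ▸[ ρ ∣ A ]) ++ G →
            Σ (Tel m' m) λ G' → Γ ≡ (Γ' ▸[ ρ ∣ A ]) ++ G' × G ≡ G' 🔒 μ
  🔒-▸-++ (G 🔒 ξ) refl = G , refl , refl

  Weakening : ∀ {k m n p} {μ ν : Hom n m} (Γ : Tel k m) (α : Cell μ ν) (Δ : Tel n p) →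
              Tm → Ty p → Set L
  Weakening {ν = ν} Γ α Δ M A = Σ Tm λ M' → Wk Γ α Δ M M' × ((Γ 🔒 ν) ++ Δ ⊢ M' ∶ A)

  weaken-varʳ : ∀ {k m n p m'} {μ ν : Hom n m} (Γ : Tel k m) (α : Cell μ ν)
                (D : Tel n m') (ρ : Hom p m') (A : Ty p) (Δ' : Tel m' p) (β : Cell ρ ∣ Δ' ∣) →
                Weakening Γ α ((D ▸[ ρ ∣ A ]) ++ Δ') (var (nvars Δ') ⌜ β ⌝₂) A
  weaken-varʳ {ν = ν} Γ α D ρ A Δ' β =
    _ , varΔ (nvars-<-▸-++ D ρ A Δ') ,
    var ((Γ 🔒 ν) ++ D) ρ Δ' β (sym (++-assoc (Γ 🔒 ν) (D ▸[ ρ ∣ A ]) Δ')) refl refl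

  -- β is retyped along ∣ (G 🔒 μ) ++ Δ ∣ ≡ (∣ G ∣ ⊚ μ) ⊚ ∣ Δ ∣, the shape in which Wk whiskers α.
  weaken-varˡ : ∀ {k m n p m'} {μ ν : Hom n m} (Γ : Tel k m') (ρ : Hom p m') (A : Ty p)
                (G : Tel m' m) (α : Cell μ ν) (Δ : Tel n p) (β : Cell ρ ∣ (G 🔒 μ) ++ Δ ∣) →
                Weakening ((Γ ▸[ ρ ∣ A ]) ++ G) α Δ (var (nvars ((G 🔒 μ) ++ Δ)) ⌜ β ⌝₂) A
  weaken-varˡ {μ = μ} {ν} Γ ρ A G α Δ β =
    _ , varΓ Γ ρ A G β' refl (nvars-++ (G 🔒 μ) Δ) (sym (⌜⌝₂-subst (∣∣-++ (G 🔒 μ) Δ) β)) ,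
    var Γ ρ ((G 🔒 ν) ++ Δ) (subst (Cell ρ) (sym (∣∣-++ (G 🔒 ν) Δ)) β″)
      (++-assoc (Γ ▸[ ρ ∣ A ]) (G 🔒 ν) Δ)
      (trans (nvars-++ (G 🔒 μ) Δ) (sym (nvars-++ (G 🔒 ν) Δ)))
      (sym (⌜⌝₂-subst (sym (∣∣-++ (G 🔒 ν) Δ)) β″))
    where
      β' : Cell ρ ((∣ G ∣ ⊚ μ) ⊚ ∣ Δ ∣)
      β' = subst (Cell ρ) (∣∣-++ (G 🔒 μ) Δ) β
      β″ : Cell ρ ((∣ G ∣ ⊚ ν) ⊚ ∣ Δ ∣)
      β″ = ((id₂ ∣ G ∣ * α) * id₂ ∣ Δ ∣) · β'

  weaken-var : ∀ {k m n p m'} {μ ν : Hom n m} (Γ : Tel k m) (α : Cell μ ν) (Δ : Tel n p)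
               (Γ' : Tel k m') (ρ : Hom p m') (A : Ty p) (Δ' : Tel m' p) (β : Cell ρ ∣ Δ' ∣) →
               (Γ 🔒 μ) ++ Δ ≡ (Γ' ▸[ ρ ∣ A ]) ++ Δ' →
               Weakening Γ α Δ (var (nvars Δ') ⌜ β ⌝₂) A
  weaken-var {μ = μ} Γ α Δ Γ' ρ A Δ' β e with split-++ (Γ 🔒 μ) Δ Γ' ρ A Δ' e
  ... | inʳ D refl = weaken-varʳ Γ α D ρ A Δ' β
  ... | inˡ G eΓ refl with 🔒-▸-++ G eΓ
  ...   | G' , refl , refl = weaken-varˡ Γ' ρ A G' α Δ β

  weaken-⊢ : ∀ {k m n p} (Γ : Tel k m) (Δ : Tel n p) {μ ν : Hom n m} (α : Cell μ ν)
             {M : Tm} {A : Ty p} {Ψ : Tel k p} →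
             Ψ ⊢ M ∶ A → Ψ ≡ (Γ 🔒 μ) ++ Δ → Weakening Γ α Δ M A
  weaken-⊢ Γ Δ α (var Γ' ρ Δ' β e refl refl) refl = weaken-var Γ α Δ Γ' ρ _ Δ' β e
  weaken-⊢ Γ Δ α (pair d e) eq =
    let M' , w , d' = weaken-⊢ Γ Δ α d eq
        N' , v , e' = weaken-⊢ Γ Δ α e eq
    in _ , pair w v , pair d' e'
  weaken-⊢ Γ Δ α (π₁ d) eq = let M' , w , d' = weaken-⊢ Γ Δ α d eq in _ , π₁ w , π₁ d'
  weaken-⊢ Γ Δ α (π₂ d) eq = let M' , w , d' = weaken-⊢ Γ Δ α d eq in _ , π₂ w , π₂ d'
  weaken-⊢ Γ Δ α (in₁ d) eq = let M' , w , d' = weaken-⊢ Γ Δ α d eq in _ , in₁ w , in₁ d'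
  weaken-⊢ Γ Δ α (in₂ d) eq = let M' , w , d' = weaken-⊢ Γ Δ α d eq in _ , in₂ w , in₂ d'
  weaken-⊢ Γ Δ α (lam {μ = ξ} {A = A} d) eq =
    let M' , w , d' = weaken-⊢ Γ (Δ ▸[ ξ ∣ A ]) α d (cong (_▸[ ξ ∣ A ]) eq)
    in _ , lam ξ A w , lam d'
  weaken-⊢ Γ Δ α (app {μ = ξ} d e) eq =
    let M' , w , d' = weaken-⊢ Γ Δ α d eq
        N' , v , e' = weaken-⊢ Γ (Δ 🔒 ξ) α e (cong (_🔒 ξ) eq)
    in _ , app ξ w v , app d' e'
  weaken-⊢ Γ Δ α (mod {μ = ξ} d) eq =
    let M' , w , d' = weaken-⊢ Γ (Δ 🔒 ξ) α d (cong (_🔒 ξ) eq)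
    in _ , mod ξ w , mod d'
  weaken-⊢ Γ Δ α (case {A = A} {B} d e f) eq =
    let M' , u , d' = weaken-⊢ Γ Δ α d eq
        P' , v , e' = weaken-⊢ Γ (Δ ▸[ id₁ _ ∣ A ]) α e (cong (_▸[ id₁ _ ∣ A ]) eq)
        Q' , w , f' = weaken-⊢ Γ (Δ ▸[ id₁ _ ∣ B ]) α f (cong (_▸[ id₁ _ ∣ B ]) eq)
    in _ , case A B u v w , case d' e' f'
  weaken-⊢ Γ Δ α (letmod {ν = ξ} {μ = ρ} {A = A} d e) eq =
    let M' , w , d' = weaken-⊢ Γ (Δ 🔒 ρ) α d (cong (_🔒 ρ) eq)
        N' , v , e' = weaken-⊢ Γ (Δ ▸[ ρ ⊚ ξ ∣ A ]) α e (cong (_▸[ ρ ⊚ ξ ∣ A ]) eq)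
    in _ , letmod ρ ξ A w v , letmod d' e'

theorem5 : ∀ {o ℓ₁ ℓ₂ : Level} (𝓜 : ModeTheory o ℓ₁ ℓ₂) → let open Syntax 𝓜 in
    ∀ {k m n p : Mode} (Γ : Tel k m) (Δ : Tel n p) {μ ν : Hom n m} (α : Cell μ ν)
      (M : Tm) (A : Ty p) →
    (Γ 🔒 μ) ++ Δ ⊢ M ∶ A →
    Σ Tm (λ M' → Wk Γ α Δ M M' × ((Γ 🔒 ν) ++ Δ ⊢ M' ∶ A))
theorem5 𝓜 Γ Δ α M A d = LockWeakening.weaken-⊢ 𝓜 Γ Δ α d refl
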